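{- Let $G$ be a niche-realizable graph. Then neither $G$ nor $\overline{G}$ has a hole of length greater than or equal to five.
   Context: All graphs are simple. A bipartite tournament is an orientation of a complete bipartite graph. The niche graph of a digraph $D$ is the graph with vertex set $V(D)$ in which distinct $u,v$ are adjacent iff there is a vertex $w$ with $(u,w),(v,w)\in A(D)$, or with $(w,u),(w,v)\in A(D)$. A graph is niche-realizable if it is the niche graph of some bipartite tournament. A hole is an induced cycle of length at least four. -}

module Defs where

open import Data.Nat using (ℕ; zero; suc)
open import Data.Fin using (Fin; toℕ)
open import Data.Bool using (Bool; true; false)
open import Data.Product using (Σ; ∃; _×_; _,_)
open import Data.Sum using (_⊎_)
open import Relation.Nullary using (¬_)
open import Relation.Binary.PropositionalEquality using (_≡_; _≢_)
open import Function.Bundles using (_⇔_)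
open import Function.Definitions using (Injective)

record Graph (n : ℕ) : Set₁ where
  field
    E     : Fin n → Fin n → Set
    sym   : ∀ {u v} → E u v → E v u
    irrefl : ∀ {u} → ¬ E u u

Compl : {n : ℕ} → (Fin n → Fin n → Set) → Fin n → Fin n → Set
Compl E u v = (u ≢ v) × ¬ E u v

Digraph : ℕ → Set
Digraph n = Fin n → Fin n → Bool

-- D is a bipartite tournament: an orientation of the complete bipartite graph
-- with parts {v | side v ≡ true} and {v | side v ≡ false}.
record IsBipartiteTournament {n : ℕ} (D : Digraph n) : Set where
  field
    side     : Fin n → Bool
    arc-across : ∀ u v → D u v ≡ true → side u ≢ side v
    complete : ∀ u v → side u ≢ side v → (D u v ≡ true) ⊎ (D v u ≡ true)
    oriented : ∀ u v → D u v ≡ true → D v u ≡ false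

NicheAdj : {n : ℕ} → Digraph n → Fin n → Fin n → Set
NicheAdj D u v =
  (u ≢ v) ×
  ((∃ λ w → D u w ≡ true × D v w ≡ true) ⊎ (∃ λ w → D w u ≡ true × D w v ≡ true))

NicheRealizable : {n : ℕ} → Graph n → Set
NicheRealizable {n} G =
  Σ (Digraph n) λ D → IsBipartiteTournament D ×
    (∀ u v → Graph.E G u v ⇔ NicheAdj D u v)

CycAdj : (k : ℕ) → Fin k → Fin k → Set
CycAdj k i j =
  (toℕ j ≡ suc (toℕ i)) ⊎ (toℕ i ≡ suc (toℕ j)) ⊎
  ((toℕ i ≡ 0 × suc (toℕ j) ≡ k) ⊎ (toℕ j ≡ 0 × suc (toℕ i) ≡ k))

-- A hole of length k (k ≥ 4 is imposed where used): an induced cycle of length k,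
-- i.e. an injective map v : Fin k → V whose induced adjacency is exactly that of C_k.
HasHole : {n : ℕ} → (Fin n → Fin n → Set) → ℕ → Set
HasHole {n} E k =
  Σ (Fin k → Fin n) λ v → Injective _≡_ _≡_ v ×
    (∀ i j → E (v i) (v j) ⇔ CycAdj k i j)

-- A niche graph of a bipartite tournament has no induced path a–b–c–d. Say the middle edge
-- bc comes from a common out-neighbour w (the in-neighbour case is the same argument in the
-- reversed tournament). Niche-adjacent vertices lie on the same side, so a and d are joined
-- to w; a → w or d → w would make a ~ c or b ~ d, hence w → a and w → d, and then a ~ d.
-- A hole of length at least five contains an induced P₄, and so does the complement of such
-- a hole, because P₄ is self-complementary.
module Submission where

open import Defs
open import Data.Nat using (ℕ; suc; _+_; _≤_; s≤s; z≤n)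
open import Data.Bool using (Bool; true; false)
open import Data.Fin using (Fin) renaming (zero to fzero; suc to fsuc)
open import Data.Product using (_×_; _,_; proj₁; proj₂)
open import Data.Sum using (inj₁; inj₂; swap)
open import Data.Empty using (⊥; ⊥-elim)
open import Relation.Nullary using (¬_)
open import Relation.Binary.PropositionalEquality using (_≡_; _≢_; refl; sym; trans)
open import Function.Bundles using (_⇔_; Equivalence; mk⇔)
open Equivalence using (to; from)

record InducedP4 {n : ℕ} (E : Fin n → Fin n → Set) : Set where
  field
    a b c d  : Fin n
    ab       : E a b
    bc       : E b c
    cd       : E c d
    ac       : Compl E a c
    bd       : Compl E b d
    ad       : Compl E a d

IsNicheGraphOf : {n : ℕ} → (Fin n → Fin n → Set) → Digraph n → Set
IsNicheGraphOf E D = ∀ u v → E u v ⇔ NicheAdj D u v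

reverse : {n : ℕ} → Digraph n → Digraph n
reverse D u v = D v u

reverse-isBipartiteTournament : {n : ℕ} {D : Digraph n} →
  IsBipartiteTournament D → IsBipartiteTournament (reverse D)
reverse-isBipartiteTournament bt = record
  { side       = side
  ; arc-across = λ u v p eq → arc-across v u p (sym eq)
  ; complete   = λ u v ne → swap (complete u v ne)
  ; oriented   = λ u v → oriented v u
  }
  where open IsBipartiteTournament bt

nicheAdj-reverse : {n : ℕ} {D : Digraph n} {u v : Fin n} →
  NicheAdj D u v ⇔ NicheAdj (reverse D) u v
nicheAdj-reverse = mk⇔ (λ (ne , adj) → ne , swap adj) (λ (ne , adj) → ne , swap adj)

reverse-isNicheGraphOf : {n : ℕ} {E : Fin n → Fin n → Set} {D : Digraph n} →
  IsNicheGraphOf E D → IsNicheGraphOf E (reverse D)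
reverse-isNicheGraphOf niche u v =
  mk⇔ (λ e → to nicheAdj-reverse (to (niche u v) e))
      (λ adj → from (niche u v) (from nicheAdj-reverse adj))

≢-both⇒≡ : {x y z : Bool} → x ≢ z → y ≢ z → x ≡ y
≢-both⇒≡ {false} {false}         _   _   = refl
≢-both⇒≡ {true}  {true}          _   _   = refl
≢-both⇒≡ {false} {true}  {false} x≢z _   = ⊥-elim (x≢z refl)
≢-both⇒≡ {false} {true}  {true}  _   y≢z = ⊥-elim (y≢z refl)
≢-both⇒≡ {true}  {false} {false} _   y≢z = ⊥-elim (y≢z refl)
≢-both⇒≡ {true}  {false} {true}  x≢z _   = ⊥-elim (x≢z refl)

module NicheGraph {n : ℕ} {E : Fin n → Fin n → Set} {D : Digraph n}
                  (bt : IsBipartiteTournament D) (niche : IsNicheGraphOf E D) where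
  open IsBipartiteTournament bt

  commonOut⇒adj : ∀ {u v w} → u ≢ v → D u w ≡ true → D v w ≡ true → E u v
  commonOut⇒adj u≢v u→w v→w = from (niche _ _) (u≢v , inj₁ (_ , u→w , v→w))

  commonIn⇒adj : ∀ {u v w} → u ≢ v → D w u ≡ true → D w v ≡ true → E u v
  commonIn⇒adj u≢v w→u w→v = from (niche _ _) (u≢v , inj₂ (_ , w→u , w→v))

  adj⇒sameSide : ∀ {u v} → E u v → side u ≡ side v
  adj⇒sameSide e with to (niche _ _) e
  ... | _ , inj₁ (w , u→w , v→w) = ≢-both⇒≡ (arc-across _ w u→w) (arc-across _ w v→w)
  ... | _ , inj₂ (w , w→u , w→v) =
    ≢-both⇒≡ (λ eq → arc-across w _ w→u (sym eq)) (λ eq → arc-across w _ w→v (sym eq))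

  arcFrom : ∀ {x w} → side x ≢ side w → ¬ D x w ≡ true → D w x ≡ true
  arcFrom {x} {w} x≁w ¬x→w with complete x w x≁w
  ... | inj₁ x→w = ⊥-elim (¬x→w x→w)
  ... | inj₂ w→x = w→x

  no-inducedP4-commonOut : (p : InducedP4 E) (let open InducedP4 p) →
    ∀ {w} → D b w ≡ true → D c w ≡ true → ⊥
  no-inducedP4-commonOut p {w} b→w c→w =
    proj₂ ad (commonIn⇒adj (proj₁ ad) w→a w→d)
    where
    open InducedP4 p
    w→a : D w a ≡ true
    w→a = arcFrom (λ eq → arc-across b w b→w (trans (sym (adj⇒sameSide ab)) eq))
                  (λ a→w → proj₂ ac (commonOut⇒adj (proj₁ ac) a→w c→w))
    w→d : D w d ≡ true
    w→d = arcFrom (λ eq → arc-across c w c→w (trans (adj⇒sameSide cd) eq))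
                  (λ d→w → proj₂ bd (commonOut⇒adj (proj₁ bd) b→w d→w))

nicheGraph-inducedP4-free : {n : ℕ} {E : Fin n → Fin n → Set} {D : Digraph n} →
  IsBipartiteTournament D → IsNicheGraphOf E D → ¬ InducedP4 E
nicheGraph-inducedP4-free bt niche p with to (niche _ _) (InducedP4.bc p)
... | _ , inj₁ (_ , b→w , c→w) = NicheGraph.no-inducedP4-commonOut bt niche p b→w c→w
... | _ , inj₂ (_ , w→b , w→c) =
  NicheGraph.no-inducedP4-commonOut
    (reverse-isBipartiteTournament bt) (reverse-isNicheGraphOf niche) p w→b w→c

compl-compl : {n : ℕ} {E : Fin n → Fin n → Set} {u v : Fin n} →
  Compl (Compl E) u v → ¬ ¬ E u v
compl-compl (u≢v , ¬compl) ¬e = ¬compl (u≢v , ¬e)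

compl-sym : {n : ℕ} (G : Graph n) {u v : Fin n} →
  Compl (Graph.E G) u v → Compl (Graph.E G) v u
compl-sym G (u≢v , ¬e) = (λ eq → u≢v (sym eq)) , (λ e → ¬e (Graph.sym G e))

-- Classically P₄ is self-complementary: a–b–c–d in the complement is c–a–d–b in G.
-- Constructively the edges of G are only recovered up to double negation.
inducedP4-compl : {n : ℕ} (G : Graph n) →
  InducedP4 (Compl (Graph.E G)) → ¬ ¬ InducedP4 (Graph.E G)
inducedP4-compl G p noP4 =
  ¬¬adj ac λ eac → ¬¬adj ad λ ead → ¬¬adj bd λ ebd →
  noP4 record
    { a = c ; b = a ; c = d ; d = b
    ; ab = Graph.sym G eac ; bc = ead ; cd = Graph.sym G ebd
    ; ac = cd ; bd = ab ; ad = compl-sym G bc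
    }
  where
  open InducedP4 p
  ¬¬adj : ∀ {u v} → Compl (Compl (Graph.E G)) u v → ¬ ¬ Graph.E G u v
  ¬¬adj = compl-compl {E = Graph.E G}

module _ {n : ℕ} (E : Fin n → Fin n → Set) (m : ℕ) where
  private
    k : ℕ
    k = 5 + m
    i₀ i₁ i₂ i₃ : Fin k
    i₀ = fzero
    i₁ = fsuc fzero
    i₂ = fsuc (fsuc fzero)
    i₃ = fsuc (fsuc (fsuc fzero))

    i₀≢i₂ : i₀ ≢ i₂
    i₀≢i₂ ()

    i₁≢i₃ : i₁ ≢ i₃
    i₁≢i₃ ()

    i₀≢i₃ : i₀ ≢ i₃
    i₀≢i₃ ()

    ¬cycAdj-0-2 : ¬ CycAdj k i₀ i₂
    ¬cycAdj-0-2 (inj₁ ())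
    ¬cycAdj-0-2 (inj₂ (inj₁ ()))
    ¬cycAdj-0-2 (inj₂ (inj₂ (inj₁ (_ , ()))))
    ¬cycAdj-0-2 (inj₂ (inj₂ (inj₂ (() , _))))

    ¬cycAdj-1-3 : ¬ CycAdj k i₁ i₃
    ¬cycAdj-1-3 (inj₁ ())
    ¬cycAdj-1-3 (inj₂ (inj₁ ()))
    ¬cycAdj-1-3 (inj₂ (inj₂ (inj₁ (() , _))))
    ¬cycAdj-1-3 (inj₂ (inj₂ (inj₂ (() , _))))

    -- this is the one place where the hole needs length at least five
    ¬cycAdj-0-3 : ¬ CycAdj k i₀ i₃
    ¬cycAdj-0-3 (inj₁ ())
    ¬cycAdj-0-3 (inj₂ (inj₁ ()))
    ¬cycAdj-0-3 (inj₂ (inj₂ (inj₁ (_ , ()))))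
    ¬cycAdj-0-3 (inj₂ (inj₂ (inj₂ (() , _))))

  hole⇒inducedP4 : HasHole E (5 + m) → InducedP4 E
  hole⇒inducedP4 (v , inj , cyc) = record
    { a = v i₀ ; b = v i₁ ; c = v i₂ ; d = v i₃
    ; ab = from (cyc i₀ i₁) (inj₁ refl)
    ; bc = from (cyc i₁ i₂) (inj₁ refl)
    ; cd = from (cyc i₂ i₃) (inj₁ refl)
    ; ac = (λ eq → i₀≢i₂ (inj eq)) , (λ e → ¬cycAdj-0-2 (to (cyc i₀ i₂) e))
    ; bd = (λ eq → i₁≢i₃ (inj eq)) , (λ e → ¬cycAdj-1-3 (to (cyc i₁ i₃) e))
    ; ad = (λ eq → i₀≢i₃ (inj eq)) , (λ e → ¬cycAdj-0-3 (to (cyc i₀ i₃) e))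
    }

proposition4p1 : (n : ℕ) (G : Graph n) → NicheRealizable G →
    (k : ℕ) → 5 ≤ k →
    ¬ HasHole (Graph.E G) k × ¬ HasHole (Compl (Graph.E G)) k
proposition4p1 n G (D , bt , niche) (suc (suc (suc (suc (suc m))))) (s≤s (s≤s (s≤s (s≤s (s≤s z≤n))))) =
  (λ hole → P4-free (hole⇒inducedP4 (Graph.E G) m hole)) ,
  (λ hole → inducedP4-compl G (hole⇒inducedP4 (Compl (Graph.E G)) m hole) P4-free)
  where
  P4-free : ¬ InducedP4 (Graph.E G)
  P4-free = nicheGraph-inducedP4-free bt niche
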